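{- A binary Steinhaus triangle $\nabla$ of size $n$ is dihedrally symmetric (i.e. $r(\nabla)=h(\nabla)=\nabla$) if and only if at least two of the three Steinhaus triangles $\nabla$, $r(\nabla)$, $r^2(\nabla)$ are horizontally symmetric.
   Context: A binary Steinhaus triangle of size $n$ is an array $(a_{i,j})_{1\le i\le j\le n}$ of elements of $\{0,1\}$ with $a_{i,j}\equiv a_{i-1,j-1}+a_{i-1,j}\pmod 2$ for $2\le i\le j\le n$. The rotation is $r((a_{i,j}))=(a_{j-i+1,n-i+1})_{1\le i\le j\le n}$ and the horizontal reflection is $h((a_{i,j}))=(a_{i,n-j+i})_{1\le i\le j\le n}$. Both map Steinhaus triangles of size $n$ to Steinhaus triangles of size $n$. A triangle $T$ is horizontally symmetric if $h(T)=T$. -}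

module Defs where

open import Data.Nat using (ℕ; _+_; _∸_; _≤_)
open import Data.Bool using (Bool; _xor_)
open import Data.Product using (_×_)
open import Data.Sum using (_⊎_)
open import Relation.Binary.PropositionalEquality using (_≡_)

-- An array (a_{i,j}) indexed by natural numbers; only entries with
-- 1 ≤ i ≤ j ≤ n are meaningful for a triangle of size n.
Array : Set
Array = ℕ → ℕ → Bool

_≈[_]_ : Array → ℕ → Array → Set
a ≈[ n ] b = ∀ i j → 1 ≤ i → i ≤ j → j ≤ n → a i j ≡ b i j

IsSteinhaus : ℕ → Array → Set
IsSteinhaus n a = ∀ i j → 2 ≤ i → i ≤ j → j ≤ n →
  a i j ≡ (a (i ∸ 1) (j ∸ 1) xor a (i ∸ 1) j)

rot : ℕ → Array → Array
rot n a i j = a (j ∸ i + 1) (n ∸ i + 1)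

hor : ℕ → Array → Array
hor n a i j = a i (n ∸ j + i)

HorSym : ℕ → Array → Set
HorSym n a = hor n a ≈[ n ] a

DihedSym : ℕ → Array → Set
DihedSym n a = (rot n a ≈[ n ] a) × (hor n a ≈[ n ] a)

AtLeastTwo : Set → Set → Set → Set
AtLeastTwo P Q R = (P × Q) ⊎ (P × R) ⊎ (Q × R)

module Submission where

-- Index the entries of a triangle of size n by barycentric
-- coordinates: the entry (i , j) with 1 ≤ i ≤ j ≤ n sits at the point
-- (x , y , z) = (i - 1 , j - i , n - j), and these points are exactly the
-- triples with x + y + z = n - 1.  In these coordinates the rotation r
-- permutes the coordinates cyclically and the reflection h swaps y and z.
-- Hence ∇, r(∇), r²(∇) are horizontally symmetric iff the entry function is
-- invariant under the transposition (y z), (x y), (x z) respectively, and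
-- r(∇) = ∇ iff it is invariant under the 3-cycle.  The theorem is then the
-- group-theoretic fact that any two transpositions of S₃ generate S₃, while
-- the 3-cycle and (y z) generate (x y).

open import Defs
open import Data.Nat using (ℕ; suc; _+_; _∸_; z≤n; s≤s)
open import Data.Nat.Properties using (+-comm; +-assoc; +-suc; m≤m+n; m+n∸m≡n; m+[n∸m]≡n)
open import Data.Bool using (Bool)
open import Data.Product using (_×_; _,_)
open import Data.Sum using (inj₁; inj₂)
open import Function using (_∘_; id)
open import Function.Bundles using (_⇔_; mk⇔; Equivalence)
open import Function.Properties.Equivalence using () renaming (trans to ⇔-trans)
open import Relation.Binary.PropositionalEquality
  using (_≡_; refl; sym; trans; cong; cong₂; subst)

open Equivalence using (to; from)

Pt : Set
Pt = ℕ × ℕ × ℕ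

swap₁₂ swap₂₃ swap₁₃ cycle : Pt → Pt
swap₁₂ (x , y , z) = (y , x , z)
swap₂₃ (x , y , z) = (x , z , y)
swap₁₃ (x , y , z) = (z , y , x)
cycle  (x , y , z) = (y , z , x)

module Invariance {A : Set} (D : Pt → Set) where

  Invariant : (Pt → Pt) → (Pt → A) → Set
  Invariant σ F = ∀ p → D p → F (σ p) ≡ F p

  compose : ∀ {σ τ F} → (∀ p → D p → D (τ p)) →
    Invariant σ F → Invariant τ F → Invariant (σ ∘ τ) F
  compose {τ = τ} τ-pres hσ hτ p d = trans (hσ (τ p) (τ-pres p d)) (hτ p d)

  conjugate : ∀ {σ F} (τ τ⁻¹ : Pt → Pt) →
    (∀ p → τ (τ⁻¹ p) ≡ p) → (∀ p → τ⁻¹ (τ p) ≡ p) →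
    (∀ p → D p → D (τ p)) → (∀ p → D p → D (τ⁻¹ p)) →
    Invariant σ (F ∘ τ) ⇔ Invariant (τ ∘ σ ∘ τ⁻¹) F
  conjugate {σ} {F} τ τ⁻¹ ττ⁻¹ τ⁻¹τ τ-pres τ⁻¹-pres = mk⇔ ⇒ ⇐
    where
    ⇒ : Invariant σ (F ∘ τ) → Invariant (τ ∘ σ ∘ τ⁻¹) F
    ⇒ h p d = subst (λ q → F (τ (σ (τ⁻¹ p))) ≡ F q) (ττ⁻¹ p) (h (τ⁻¹ p) (τ⁻¹-pres p d))
    ⇐ : Invariant (τ ∘ σ ∘ τ⁻¹) F → Invariant σ (F ∘ τ)
    ⇐ h p d = subst (λ q → F (τ (σ q)) ≡ F (τ p)) (τ⁻¹τ p) (h (τ p) (τ-pres p d))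

Bary : ℕ → Pt → Set
Bary n (x , y , z) = suc (x + y + z) ≡ n

open Invariance {Bool} using (Invariant; compose; conjugate)

swap₁₂-pres : ∀ {n} p → Bary n p → Bary n (swap₁₂ p)
swap₁₂-pres (x , y , z) d = trans (cong (λ k → suc (k + z)) (+-comm y x)) d

swap₂₃-pres : ∀ {n} p → Bary n p → Bary n (swap₂₃ p)
swap₂₃-pres (x , y , z) d =
  trans (cong suc (trans (+-assoc x z y)
    (trans (cong (x +_) (+-comm z y)) (sym (+-assoc x y z))))) d

cycle-pres : ∀ {n} p → Bary n p → Bary n (cycle p)
cycle-pres p d = swap₂₃-pres (swap₁₂ p) (swap₁₂-pres p d)

cycle²-pres : ∀ {n} p → Bary n p → Bary n (cycle (cycle p))
cycle²-pres p d = cycle-pres (cycle p) (cycle-pres p d)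

swap₁₃-pres : ∀ {n} p → Bary n p → Bary n (swap₁₃ p)
swap₁₃-pres p d = swap₁₂-pres (swap₂₃ (swap₁₂ p)) (cycle-pres p d)

module S₃ {n : ℕ} {F : Pt → Bool} where

  cycle-from-23-12 : Invariant (Bary n) swap₂₃ F → Invariant (Bary n) swap₁₂ F →
    Invariant (Bary n) cycle F
  cycle-from-23-12 = compose (Bary n) swap₁₂-pres

  cycle-from-13-23 : Invariant (Bary n) swap₁₃ F → Invariant (Bary n) swap₂₃ F →
    Invariant (Bary n) cycle F
  cycle-from-13-23 = compose (Bary n) swap₂₃-pres

  -- swap₂₃ = swap₁₂ ∘ swap₁₃ ∘ swap₁₂
  swap₂₃-from-12-13 : Invariant (Bary n) swap₁₂ F → Invariant (Bary n) swap₁₃ F →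
    Invariant (Bary n) swap₂₃ F
  swap₂₃-from-12-13 h₁₂ h₁₃ =
    compose (Bary n) (λ p d → swap₁₃-pres (swap₁₂ p) (swap₁₂-pres p d)) h₁₂
      (compose (Bary n) swap₁₂-pres h₁₃ h₁₂)

  swap₁₂-from-23-cycle : Invariant (Bary n) swap₂₃ F → Invariant (Bary n) cycle F →
    Invariant (Bary n) swap₁₂ F
  swap₁₂-from-23-cycle = compose (Bary n) cycle-pres

entry : Array → Pt → Bool
entry a (x , y , z) = a (suc x) (suc (x + y))

triangle⇔bary : ∀ {n} (f g : Array) →
  (f ≈[ n ] g) ⇔ (∀ p → Bary n p → entry f p ≡ entry g p)
triangle⇔bary {n} f g = mk⇔ ⇒ ⇐
  where
  ⇒ : f ≈[ n ] g → ∀ p → Bary n p → entry f p ≡ entry g p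
  ⇒ h (x , y , z) refl =
    h (suc x) (suc (x + y)) (s≤s z≤n) (s≤s (m≤m+n x y)) (s≤s (m≤m+n (x + y) z))
  ⇐ : (∀ p → Bary n p → entry f p ≡ entry g p) → f ≈[ n ] g
  ⇐ h (suc x) (suc j) (s≤s z≤n) (s≤s x≤j) (s≤s {n = m} j≤m) =
    subst (λ k → f (suc x) (suc k) ≡ g (suc x) (suc k)) (m+[n∸m]≡n x≤j)
      (h (x , j ∸ x , m ∸ j) (cong suc
        (trans (cong (_+ (m ∸ j)) (m+[n∸m]≡n x≤j)) (m+[n∸m]≡n j≤m))))

rot-entry : ∀ {n} (a : Array) p → Bary n p → entry (rot n a) p ≡ entry a (cycle p)
rot-entry a (x , y , z) refl = cong₂ a row column
  where
  row : (x + y ∸ x) + 1 ≡ suc y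
  row = trans (cong (_+ 1) (m+n∸m≡n x y)) (+-comm y 1)
  column : (x + y + z ∸ x) + 1 ≡ suc (y + z)
  column = trans (cong (λ k → (k ∸ x) + 1) (+-assoc x y z))
    (trans (cong (_+ 1) (m+n∸m≡n x (y + z))) (+-comm (y + z) 1))

hor-entry : ∀ {n} (a : Array) p → Bary n p → entry (hor n a) p ≡ entry a (swap₂₃ p)
hor-entry a (x , y , z) refl = cong (a (suc x))
  (trans (cong (_+ suc x) (m+n∸m≡n (x + y) z)) (trans (+-suc z x) (cong suc (+-comm z x))))

agree⇔ : ∀ {n} (f g : Array) (F : Pt → Bool) (α β : Pt → Pt) →
  (∀ p → Bary n p → entry f p ≡ F (α p)) → (∀ p → Bary n p → entry g p ≡ F (β p)) →
  (f ≈[ n ] g) ⇔ (∀ p → Bary n p → F (α p) ≡ F (β p))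
agree⇔ {n} f g F α β f≡ g≡ = ⇔-trans (triangle⇔bary f g) (mk⇔ ⇒ ⇐)
  where
  ⇒ : (∀ p → Bary n p → entry f p ≡ entry g p) → ∀ p → Bary n p → F (α p) ≡ F (β p)
  ⇒ h p d = trans (sym (f≡ p d)) (trans (h p d) (g≡ p d))
  ⇐ : (∀ p → Bary n p → F (α p) ≡ F (β p)) → ∀ p → Bary n p → entry f p ≡ entry g p
  ⇐ h p d = trans (f≡ p d) (trans (h p d) (sym (g≡ p d)))

module Symmetries (n : ℕ) (a : Array) where

  rot²-entry : ∀ p → Bary n p → entry (rot n (rot n a)) p ≡ entry a (cycle (cycle p))
  rot²-entry p d = trans (rot-entry (rot n a) p d) (rot-entry a (cycle p) (cycle-pres p d))

  rot⇔cycle : (rot n a ≈[ n ] a) ⇔ Invariant (Bary n) cycle (entry a)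
  rot⇔cycle = agree⇔ (rot n a) a (entry a) cycle id (rot-entry a) (λ _ _ → refl)

  hor⇔swap₂₃ : HorSym n a ⇔ Invariant (Bary n) swap₂₃ (entry a)
  hor⇔swap₂₃ = agree⇔ (hor n a) a (entry a) swap₂₃ id (hor-entry a) (λ _ _ → refl)

  -- (x y) = cycle ∘ (y z) ∘ cycle⁻¹
  rot-hor⇔swap₁₂ : HorSym n (rot n a) ⇔ Invariant (Bary n) swap₁₂ (entry a)
  rot-hor⇔swap₁₂ = ⇔-trans
    (agree⇔ (hor n (rot n a)) (rot n a) (entry a) (cycle ∘ swap₂₃) cycle
      (λ p d → trans (hor-entry (rot n a) p d) (rot-entry a (swap₂₃ p) (swap₂₃-pres p d)))
      (rot-entry a))
    (conjugate (Bary n) {swap₂₃} {entry a} cycle (cycle ∘ cycle) (λ _ → refl) (λ _ → refl)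
      cycle-pres cycle²-pres)

  -- (x z) = cycle² ∘ (y z) ∘ cycle⁻²
  rot²-hor⇔swap₁₃ : HorSym n (rot n (rot n a)) ⇔ Invariant (Bary n) swap₁₃ (entry a)
  rot²-hor⇔swap₁₃ = ⇔-trans
    (agree⇔ (hor n (rot n (rot n a))) (rot n (rot n a)) (entry a)
      (cycle ∘ cycle ∘ swap₂₃) (cycle ∘ cycle)
      (λ p d → trans (hor-entry (rot n (rot n a)) p d) (rot²-entry (swap₂₃ p) (swap₂₃-pres p d)))
      rot²-entry)
    (conjugate (Bary n) {swap₂₃} {entry a} (cycle ∘ cycle) cycle (λ _ → refl) (λ _ → refl)
      cycle²-pres cycle-pres)

mainTheorem18 : (n : ℕ) (a : Array) → IsSteinhaus n a →
    DihedSym n a ⇔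
      AtLeastTwo (HorSym n a) (HorSym n (rot n a)) (HorSym n (rot n (rot n a)))
mainTheorem18 n a _ = mk⇔ ⇒ ⇐
  where
  open Symmetries n a
  open S₃ {n} {entry a}

  ⇒ : DihedSym n a → AtLeastTwo (HorSym n a) (HorSym n (rot n a)) (HorSym n (rot n (rot n a)))
  ⇒ (r , h) = inj₁ (h , from rot-hor⇔swap₁₂
    (swap₁₂-from-23-cycle (to hor⇔swap₂₃ h) (to rot⇔cycle r)))

  ⇐ : AtLeastTwo (HorSym n a) (HorSym n (rot n a)) (HorSym n (rot n (rot n a))) → DihedSym n a
  ⇐ (inj₁ (h₂₃ , h₁₂)) =
    from rot⇔cycle (cycle-from-23-12 (to hor⇔swap₂₃ h₂₃) (to rot-hor⇔swap₁₂ h₁₂)) , h₂₃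
  ⇐ (inj₂ (inj₁ (h₂₃ , h₁₃))) =
    from rot⇔cycle (cycle-from-13-23 (to rot²-hor⇔swap₁₃ h₁₃) (to hor⇔swap₂₃ h₂₃)) , h₂₃
  ⇐ (inj₂ (inj₂ (h₁₂ , h₁₃))) =
    from rot⇔cycle (cycle-from-23-12 i₂₃ i₁₂) , from hor⇔swap₂₃ i₂₃
    where
    i₁₂ : Invariant (Bary n) swap₁₂ (entry a)
    i₁₂ = to rot-hor⇔swap₁₂ h₁₂
    i₂₃ : Invariant (Bary n) swap₂₃ (entry a)
    i₂₃ = swap₂₃-from-12-13 i₁₂ (to rot²-hor⇔swap₁₃ h₁₃)
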